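{- Let $m\ge2$ be such that $m+1$ is a power of $2$, and let $X$ and $f$ be the two-digit base-$m$ Kaprekar system. Then the only fixed set is the trivial one: $K(x)=\{0\}$ for every $x\in X$.
   Context: $X=\{0,1,\dots,m^2-1\}$, each element written with exactly two base-$m$ digits $x=d_1m+d_0$ (leading zeros allowed). The map is $f(x)=\big(m\max(d_0,d_1)+\min(d_0,d_1)\big)-\big(m\min(d_0,d_1)+\max(d_0,d_1)\big)$. Iterates: $f^0=\mathrm{id}$ and $f^t=f\circ f^{t-1}$. For $x\in X$: $S(x)$ is the least $s\ge0$ such that $f^{s+t}(x)=f^s(x)$ for some $t\ge1$. $T(x)$ is the least $t\ge1$ with $f^{S(x)+t}(x)=f^{S(x)}(x)$. The fixed set is $K(x)=\{f^{S(x)+i}(x):0\le i<T(x)\}$. -}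

module Defs where

open import Data.Nat using (ℕ; zero; suc; _+_; _*_; _∸_; _⊔_; _⊓_; _≤_; _<_; NonZero)
open import Data.Nat.DivMod using (_/_; _%_)
open import Data.Product using (Σ; ∃; _×_; _,_)
open import Relation.Binary.PropositionalEquality using (_≡_)
open import Relation.Nullary using (¬_)

-- The subtraction is natural-number
-- truncated subtraction, but the minuend is always ≥ the subtrahend
-- (since max ≥ min and m ≥ 1), so it agrees with the integer difference.
kap : (m : ℕ) → .{{NonZero m}} → ℕ → ℕ
kap m x =
  let d₁ = x / m
      d₀ = x % m
  in (m * (d₀ ⊔ d₁) + (d₀ ⊓ d₁)) ∸ (m * (d₀ ⊓ d₁) + (d₀ ⊔ d₁))

iter : (ℕ → ℕ) → ℕ → ℕ → ℕ
iter f zero x = x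
iter f (suc t) x = f (iter f t x)

IsPreperiodic : (ℕ → ℕ) → ℕ → ℕ → Set
IsPreperiodic f x s = ∃ λ t → 1 ≤ t × iter f (s + t) x ≡ iter f s x

IsS : (ℕ → ℕ) → ℕ → ℕ → Set
IsS f x s = IsPreperiodic f x s × (∀ s' → s' < s → ¬ IsPreperiodic f x s')

IsT : (ℕ → ℕ) → ℕ → ℕ → ℕ → Set
IsT f x s t = (1 ≤ t × iter f (s + t) x ≡ iter f s x)
            × (∀ t' → 1 ≤ t' → t' < t → ¬ (iter f (s + t') x ≡ iter f s x))

InK : (ℕ → ℕ) → ℕ → ℕ → ℕ → ℕ → Set
InK f x s t y = ∃ λ i → i < t × y ≡ iter f (s + i) x

{-# OPTIONS --safe #-}
module Submission where

-- Writing m = p + 1, the map sends x to p·d, where d ≤ p is the difference of the digits of x,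
-- and on such multiples it acts as p·d ↦ p·∣(p + 2) − 2d∣ (for d > 0).  When p + 2 = 2ᵏ and
-- 2ʲ ∣ d with j < k, then 2ʲ⁺¹ ∣ ∣(p + 2) − 2d∣, while nonzero values stay ≤ p < 2ᵏ; so every
-- orbit reaches 0 within k + 1 steps.  Since 0 is a fixed point, the least preperiod is the
-- first hitting time of 0, the period is 1, and K(x) = {0}.

open import Defs
open import Data.Nat using (ℕ; zero; suc; _+_; _*_; _∸_; _^_; _≤_; _<_; _⊔_; _⊓_; z≤n; s≤s; NonZero; ∣_-_∣; _≟_)
open import Data.Nat.Properties
open import Data.Nat.DivMod
open import Data.Nat.Divisibility using (_∣_; divides; ∣⇒≤; n∣m*n; m∣m*n)
open import Data.Nat.Tactic.RingSolver using (solve-∀)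
open import Data.Product using (∃; _×_; _,_)
open import Data.Sum using (_⊎_; inj₁; inj₂)
open import Data.Empty using (⊥-elim)
open import Relation.Binary.PropositionalEquality
open import Relation.Nullary using (¬_; Dec; yes; no)
open import Function.Base using (case_of_)
open import Function.Bundles using (_⇔_; mk⇔)

private
  variable
    f g : ℕ → ℕ

iter-+ : ∀ m n x → iter f (m + n) x ≡ iter f m (iter f n x)
iter-+ zero    n x = refl
iter-+ {f} (suc m) n x = cong f (iter-+ m n x)

iter-sucʳ : ∀ n x → iter f (suc n) x ≡ iter f n (f x)
iter-sucʳ zero    x = refl
iter-sucʳ {f} (suc n) x = cong f (iter-sucʳ n x)

iter-fixedPoint : ∀ {a} → f a ≡ a → ∀ n → iter f n a ≡ a
iter-fixedPoint fa≡a zero    = refl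
iter-fixedPoint {f} fa≡a (suc n) = trans (cong f (iter-fixedPoint fa≡a n)) fa≡a

iter-absorbed : ∀ {a x n N} → f a ≡ a → iter f n x ≡ a → n ≤ N → iter f N x ≡ a
iter-absorbed {f} {a} {x} {n} {N} fa≡a fⁿx≡a n≤N = begin
  iter f N x                   ≡⟨ cong (λ k → iter f k x) (sym (m∸n+n≡m n≤N)) ⟩
  iter f (N ∸ n + n) x         ≡⟨ iter-+ (N ∸ n) n x ⟩
  iter f (N ∸ n) (iter f n x)  ≡⟨ cong (iter f (N ∸ n)) fⁿx≡a ⟩
  iter f (N ∸ n) a             ≡⟨ iter-fixedPoint fa≡a (N ∸ n) ⟩
  a                            ∎
  where open ≡-Reasoning

iter-periodic : ∀ {s t x} → iter f (s + t) x ≡ iter f s x → ∀ j → iter f (j * t + s) x ≡ iter f s x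
iter-periodic                     period zero    = refl
iter-periodic {f} {s} {t} {x} period (suc j) = begin
  iter f (t + j * t + s) x         ≡⟨ cong (λ k → iter f k x) (+-assoc t (j * t) s) ⟩
  iter f (t + (j * t + s)) x       ≡⟨ iter-+ t (j * t + s) x ⟩
  iter f t (iter f (j * t + s) x)  ≡⟨ cong (iter f t) (iter-periodic period j) ⟩
  iter f t (iter f s x)            ≡⟨ sym (iter-+ t s x) ⟩
  iter f (t + s) x                 ≡⟨ cong (λ k → iter f k x) (+-comm t s) ⟩
  iter f (s + t) x                 ≡⟨ period ⟩
  iter f s x                       ∎
  where open ≡-Reasoning

iter-semiconj : ∀ (P : ℕ → Set) (h : ℕ → ℕ) →
  (∀ {d} → P d → f (h d) ≡ h (g d)) → (∀ {d} → P d → P (g d)) →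
  ∀ n {d} → P d → iter f n (h d) ≡ h (iter g n d)
iter-semiconj P h commute preserve zero    Pd = refl
iter-semiconj {f} {g} P h commute preserve (suc n) {d} Pd = begin
  iter f (suc n) (h d)    ≡⟨ iter-sucʳ n (h d) ⟩
  iter f n (f (h d))      ≡⟨ cong (iter f n) (commute Pd) ⟩
  iter f n (h (g d))      ≡⟨ iter-semiconj P h commute preserve n (preserve Pd) ⟩
  h (iter g n (g d))      ≡⟨ cong h (sym (iter-sucʳ n d)) ⟩
  h (iter g (suc n) d)    ∎
  where open ≡-Reasoning

Minimal : (ℕ → Set) → ℕ → Set
Minimal P s = P s × (∀ s′ → s′ < s → ¬ P s′)

module _ {P : ℕ → Set} (P? : ∀ n → Dec (P n)) where

  private
    minimal-below : ∀ n → (∀ s → s < n → ¬ P s) ⊎ ∃ (Minimal P)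
    minimal-below zero = inj₁ λ _ ()
    minimal-below (suc n) with minimal-below n | P? n
    ... | inj₂ minimal | _      = inj₂ minimal
    ... | inj₁ none    | yes Pn = inj₂ (n , Pn , none)
    ... | inj₁ none    | no ¬Pn = inj₁ λ s s<1+n → case m<1+n⇒m<n∨m≡n s<1+n of λ where
      (inj₁ s<n)  → none s s<n
      (inj₂ refl) → ¬Pn

  minimal-witness : ∀ {n} → P n → ∃ (Minimal P)
  minimal-witness {n} Pn with minimal-below (suc n)
  ... | inj₁ none    = ⊥-elim (none n ≤-refl Pn)
  ... | inj₂ minimal = minimal

module _ {a : ℕ} (fa≡a : f a ≡ a) where

  ¬preperiodic-before-absorption : ∀ {x n s} → iter f n x ≡ a → iter f s x ≢ a →
                                   ¬ IsPreperiodic f x s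
  ¬preperiodic-before-absorption fⁿx≡a fˢx≢a (zero , () , _)
  ¬preperiodic-before-absorption {x} {n} {s} fⁿx≡a fˢx≢a (t@(suc _) , _ , period) =
    fˢx≢a (trans (sym (iter-periodic {s = s} {t} {x} period n)) (iter-absorbed {n = n} fa≡a fⁿx≡a n≤nt+s))
    where
      n≤nt+s : n ≤ n * t + s
      n≤nt+s = ≤-trans (m≤m*n n t) (m≤m+n (n * t) s)

  absorbed-orbit : ∀ {x} → (∃ λ n → iter f n x ≡ a) →
    ∃ λ s → ∃ λ t → IsS f x s × IsT f x s t × (∀ y → InK f x s t y ⇔ y ≡ a)
  absorbed-orbit {x} (n , fⁿx≡a) with minimal-witness (λ s → iter f s x ≟ a) {n} fⁿx≡a
  ... | s , fˢx≡a , earlier≢a = s , 1 , isS , isT , K≡a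
    where
      fˢ⁺⁰x≡a : iter f (s + 0) x ≡ a
      fˢ⁺⁰x≡a = trans (cong (λ k → iter f k x) (+-identityʳ s)) fˢx≡a
      fˢ⁺¹x≡fˢx : iter f (s + 1) x ≡ iter f s x
      fˢ⁺¹x≡fˢx = trans (cong (λ k → iter f k x) (+-comm s 1)) (trans (cong f fˢx≡a) (trans fa≡a (sym fˢx≡a)))
      isS : IsS f x s
      isS = (1 , ≤-refl , fˢ⁺¹x≡fˢx)
          , λ s′ s′<s → ¬preperiodic-before-absorption {x} {n} {s′} fⁿx≡a (earlier≢a s′ s′<s)
      isT : IsT f x s 1
      isT = (≤-refl , fˢ⁺¹x≡fˢx) , λ { _ (s≤s z≤n) (s≤s ()) }
      K≡a : ∀ y → InK f x s 1 y ⇔ y ≡ a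
      K≡a y = mk⇔ (λ { (zero , _ , y≡fˢ⁺⁰x) → trans y≡fˢ⁺⁰x fˢ⁺⁰x≡a ; (suc _ , s≤s () , _) })
                  (λ y≡a → 0 , s≤s z≤n , trans y≡a (sym fˢ⁺⁰x≡a))

m⊓n+∣m-n∣≡m⊔n : ∀ a b → (a ⊓ b) + ∣ a - b ∣ ≡ a ⊔ b
m⊓n+∣m-n∣≡m⊔n a b with ≤-total a b
... | inj₁ a≤b = begin
  (a ⊓ b) + ∣ a - b ∣  ≡⟨ cong₂ _+_ (m≤n⇒m⊓n≡m a≤b) (m≤n⇒∣m-n∣≡n∸m a≤b) ⟩
  a + (b ∸ a)          ≡⟨ m+[n∸m]≡n a≤b ⟩
  b                    ≡⟨ sym (m≤n⇒m⊔n≡n a≤b) ⟩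
  a ⊔ b                ∎
  where open ≡-Reasoning
... | inj₂ b≤a = begin
  (a ⊓ b) + ∣ a - b ∣  ≡⟨ cong₂ _+_ (m≥n⇒m⊓n≡n b≤a) (trans (∣-∣-comm a b) (m≤n⇒∣m-n∣≡n∸m b≤a)) ⟩
  b + (a ∸ b)          ≡⟨ m+[n∸m]≡n b≤a ⟩
  a                    ≡⟨ sym (m≥n⇒m⊔n≡m b≤a) ⟩
  a ⊔ b                ∎
  where open ≡-Reasoning

∣m∣n⇒∣∣m-n∣ : ∀ {d m n} → d ∣ m → d ∣ n → d ∣ ∣ m - n ∣
∣m∣n⇒∣∣m-n∣ {d} (divides q refl) (divides q′ refl) = divides ∣ q - q′ ∣ (sym (*-distribʳ-∣-∣ d q q′))

[r+e*m]%m≡r : ∀ {m} .{{_ : NonZero m}} {r} e → r < m → (r + e * m) % m ≡ r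
[r+e*m]%m≡r {m} {r} e r<m = trans ([m+kn]%n≡m%n r e m) (m<n⇒m%n≡m r<m)

[r+e*m]/m≡e : ∀ {m} .{{_ : NonZero m}} {r} e → r < m → (r + e * m) / m ≡ e
[r+e*m]/m≡e {m} {r} e r<m =
  trans (+-distrib-/-∣ʳ r (n∣m*n e)) (cong₂ _+_ (m<n⇒m/n≡0 r<m) (m*n/n≡m e m))

p*[1+e]≡[p∸e]+e*[1+p] : ∀ {p e} → e ≤ p → p * suc e ≡ p ∸ e + e * suc p
p*[1+e]≡[p∸e]+e*[1+p] {p} {e} e≤p = begin
  p * suc e              ≡⟨ *-suc p e ⟩
  p + p * e              ≡⟨ cong₂ _+_ (sym (m∸n+n≡m e≤p)) (*-comm p e) ⟩
  p ∸ e + e + e * p      ≡⟨ +-assoc (p ∸ e) e (e * p) ⟩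
  p ∸ e + (e + e * p)    ≡⟨ cong (p ∸ e +_) (sym (*-suc e p)) ⟩
  p ∸ e + e * suc p      ∎
  where open ≡-Reasoning

digitSwap-difference : ∀ p a b →
  (suc p * (a ⊔ b) + (a ⊓ b)) ∸ (suc p * (a ⊓ b) + (a ⊔ b)) ≡ p * ∣ a - b ∣
digitSwap-difference p a b = begin
  (suc p * (a ⊔ b) + v) ∸ (suc p * v + (a ⊔ b))
    ≡⟨ cong (λ u → (suc p * u + v) ∸ (suc p * v + u)) (sym (m⊓n+∣m-n∣≡m⊔n a b)) ⟩
  (suc p * (v + c) + v) ∸ (suc p * v + (v + c))
    ≡⟨ cong (_∸ (suc p * v + (v + c))) (expand p v c) ⟩
  (suc p * v + (v + c) + p * c) ∸ (suc p * v + (v + c))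
    ≡⟨ m+n∸m≡n (suc p * v + (v + c)) (p * c) ⟩
  p * c
    ∎
  where
    open ≡-Reasoning
    v = a ⊓ b
    c = ∣ a - b ∣
    expand : ∀ p v c → suc p * (v + c) + v ≡ suc p * v + (v + c) + p * c
    expand = solve-∀

kap-closedForm : ∀ p x → kap (suc p) x ≡ p * ∣ x % suc p - x / suc p ∣
kap-closedForm p x = digitSwap-difference p (x % suc p) (x / suc p)

kap-0 : ∀ p → kap (suc p) 0 ≡ 0
kap-0 p = trans (kap-closedForm p 0) (*-zeroʳ p)

-- For 0 < d ≤ p the base-(p+1) digits of p·d are d − 1 and p + 1 − d, so kap (p·d) = p · digitGap p d.
digitGap : ℕ → ℕ → ℕ
digitGap p zero      = 0
digitGap p d@(suc _) = ∣ 2 + p - 2 * d ∣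

digitGap-suc : ∀ {p e} → e ≤ p → digitGap p (suc e) ≡ ∣ p ∸ e - e ∣
digitGap-suc {p} {e} e≤p = begin
  ∣ 2 + p - 2 * suc e ∣                  ≡⟨ cong₂ ∣_-_∣ (cong (2 +_) (sym (m+[n∸m]≡n e≤p))) (double-suc e) ⟩
  ∣ (2 + e) + (p ∸ e) - (2 + e) + e ∣    ≡⟨ ∣m+n-m+o∣≡∣n-o∣ (2 + e) (p ∸ e) e ⟩
  ∣ p ∸ e - e ∣                          ∎
  where
    open ≡-Reasoning
    double-suc : ∀ e → 2 * suc e ≡ 2 + e + e
    double-suc = solve-∀

digitGap-≤ : ∀ {p d} → d ≤ p → digitGap p d ≤ p
digitGap-≤ {p} {zero}  _   = z≤n
digitGap-≤ {p} {suc e} d≤p = begin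
  digitGap p (suc e)  ≡⟨ digitGap-suc e≤p ⟩
  ∣ p ∸ e - e ∣       ≤⟨ ∣m-n∣≤m⊔n (p ∸ e) e ⟩
  (p ∸ e) ⊔ e         ≤⟨ ⊔-lub (m∸n≤m p e) e≤p ⟩
  p                   ∎
  where
    open ≤-Reasoning
    e≤p = <⇒≤ d≤p

kap-multiple : ∀ {p d} → d ≤ p → kap (suc p) (p * d) ≡ p * digitGap p d
kap-multiple {p} {zero}  _   = begin
  kap (suc p) (p * 0)  ≡⟨ cong (kap (suc p)) (*-zeroʳ p) ⟩
  kap (suc p) 0        ≡⟨ kap-0 p ⟩
  0                    ≡⟨ sym (*-zeroʳ p) ⟩
  p * 0                ∎
  where open ≡-Reasoning
kap-multiple {p} {suc e} d≤p = begin
  kap (suc p) (p * suc e)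
    ≡⟨ cong (kap (suc p)) (p*[1+e]≡[p∸e]+e*[1+p] e≤p) ⟩
  kap (suc p) y
    ≡⟨ kap-closedForm p y ⟩
  p * ∣ y % suc p - y / suc p ∣
    ≡⟨ cong₂ (λ u v → p * ∣ u - v ∣) ([r+e*m]%m≡r e r<m) ([r+e*m]/m≡e e r<m) ⟩
  p * ∣ p ∸ e - e ∣
    ≡⟨ cong (p *_) (sym (digitGap-suc e≤p)) ⟩
  p * digitGap p (suc e)
    ∎
  where
    open ≡-Reasoning
    e≤p = <⇒≤ d≤p
    y = p ∸ e + e * suc p
    r<m : p ∸ e < suc p
    r<m = s≤s (m∸n≤m p e)

-- When 2 + p = 2ᵏ the hypothesis says 2ᵏ⁻ʳ ∣ d; it is preserved since digitGap p d ≡ ±2d mod 2 + p.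
digitGap-reaches-0 : ∀ p r {d} → d ≤ p → 2 + p ∣ 2 ^ r * d → iter (digitGap p) r d ≡ 0
digitGap-reaches-0 p zero    {zero}  _   _       = refl
digitGap-reaches-0 p zero    {suc e} d≤p 2+p∣d   =
  ⊥-elim (<⇒≱ (s≤s (m≤n⇒m≤1+n d≤p)) (∣⇒≤ (subst (2 + p ∣_) (*-identityˡ (suc e)) 2+p∣d)))
digitGap-reaches-0 p (suc r) {zero}  _   _       = iter-fixedPoint {digitGap p} refl (suc r)
digitGap-reaches-0 p (suc r) {d@(suc _)} d≤p 2+p∣2ʳ⁺¹d =
  trans (iter-sucʳ r d) (digitGap-reaches-0 p r (digitGap-≤ d≤p) 2+p∣2ʳ·gap)
  where
    2ʳ⁺¹d≡2ʳ[2d] : 2 ^ suc r * d ≡ 2 ^ r * (2 * d)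
    2ʳ⁺¹d≡2ʳ[2d] = trans (cong (_* d) (*-comm 2 (2 ^ r))) (*-assoc (2 ^ r) 2 d)
    2+p∣2ʳ·gap : 2 + p ∣ 2 ^ r * digitGap p d
    2+p∣2ʳ·gap = subst (2 + p ∣_) (sym (*-distribˡ-∣-∣ (2 ^ r) (2 + p) (2 * d)))
      (∣m∣n⇒∣∣m-n∣ (n∣m*n (2 ^ r)) (subst (2 + p ∣_) 2ʳ⁺¹d≡2ʳ[2d] 2+p∣2ʳ⁺¹d))

kap-reaches-0 : ∀ p k → 2 + p ≡ 2 ^ k → ∀ x → x < suc p * suc p → iter (kap (suc p)) (suc k) x ≡ 0
kap-reaches-0 p k 2+p≡2ᵏ x x<m² = begin
  iter (kap (suc p)) (suc k) x          ≡⟨ iter-sucʳ k x ⟩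
  iter (kap (suc p)) k (kap (suc p) x)  ≡⟨ cong (iter (kap (suc p)) k) (kap-closedForm p x) ⟩
  iter (kap (suc p)) k (p * d)          ≡⟨ iter-semiconj (_≤ p) (p *_) kap-multiple digitGap-≤ k d≤p ⟩
  p * iter (digitGap p) k d             ≡⟨ cong (p *_) (digitGap-reaches-0 p k d≤p 2+p∣2ᵏd) ⟩
  p * 0                                 ≡⟨ *-zeroʳ p ⟩
  0                                     ∎
  where
    open ≡-Reasoning
    d = ∣ x % suc p - x / suc p ∣
    d≤p : d ≤ p
    d≤p = ≤-trans (∣m-n∣≤m⊔n (x % suc p) (x / suc p))
                  (⊔-lub (≤-pred (m%n<n x (suc p))) (≤-pred (m<n*o⇒m/o<n x<m²)))
    2+p∣2ᵏd : 2 + p ∣ 2 ^ k * d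
    2+p∣2ᵏd = subst (_∣ 2 ^ k * d) (sym 2+p≡2ᵏ) (m∣m*n d)

corollary3p3p2 : (m : ℕ) → .{{_ : NonZero m}} → 2 ≤ m → (∃ λ k → m + 1 ≡ 2 ^ k) →
    ∀ x → x < m * m →
      ∃ λ s → ∃ λ t → IsS (kap m) x s × IsT (kap m) x s t
        × (∀ y → InK (kap m) x s t y ⇔ y ≡ 0)
corollary3p3p2 (suc p) _ (k , m+1≡2ᵏ) x x<m² =
  absorbed-orbit (kap-0 p) (suc k , kap-reaches-0 p k (trans (+-comm 1 (suc p)) m+1≡2ᵏ) x x<m²)
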